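{- Let $\mathcal I\in\{\mathcal I^{\mathsf{cycle}},\mathcal I^{\mathsf{path}}\}$, let $\rho\in(0,1]$, let $t>0$, and let $\mu:\mathbb{Z}_n\to\mathbb{R}_{\ge0}$ be a probability distribution. Then there exists $I\in\mathcal I$ satisfying $\rho|I^*|\le t$ and $\mu[I]\ge\frac12\cdot t\cdot R_t(\mu)$.
   Context: A circular interval is $\langle\!\langle i,d\rangle\!\rangle$ with $i\in\mathbb{Z}_n$, $d\in\mathbb{Z}$; for $d\ge0$ its elements are the multiset $\{i,i+1,\dots,i+d-1\}$ (mod $n$), and for $d<0$ the multiset $\{i,i-1,\dots,i-|d|+1\}$; $|I|=|d|$. Edge $e\in\mathbb{Z}_n$ of the cycle joins vertices $e$ and $e+1$ (mod $n$). The edge set $I^*$ of $\langle\!\langle i,d\rangle\!\rangle$ is $\emptyset$ if $d=0$, $\langle\!\langle i,d-1\rangle\!\rangle$ if $d\ge1$, and $\langle\!\langle i-1,1-|d|\rangle\!\rangle$ if $d\le-1$ (so $|I^*|=\max(|I|-1,0)$). $\mathcal I^{\mathsf{cycle}}$ is the set of all circular intervals and $\mathcal I^{\mathsf{path}}$ the set of circular intervals $I$ with $n-1\notin I^*$. For $u:\mathbb{Z}_n\to\mathbb{R}$, $u[I]=\sum_{s\in I}u_s$ counted with multiplicity. The relative concentration is $R_t(\mu)=\max_{I\in\mathcal I,\,|I|\le n}\frac{\mu[I]}{\max\{\rho|I^*|,t\}}$. -}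

module Defs where

open import Level using (0ℓ)
open import Data.Nat as ℕ using (ℕ; zero; suc)
import Data.Nat.DivMod as ℕD
open import Data.Integer as ℤ using (ℤ; +_; -[1+_]; _%ℕ_; ∣_∣)
open import Data.Fin as Fin using (Fin; toℕ)
open import Data.Fin.Properties using () renaming (_≟_ to _≟F_)
open import Data.List using (List; []; _∷_; map; upTo; allFin; _++_; concatMap; filter; foldr)
open import Data.List.Relation.Unary.Any using (Any; any?)
open import Data.Product using (Σ; ∃; _×_; _,_; proj₁; proj₂)
open import Data.Sum using (_⊎_; inj₁; inj₂)
open import Relation.Nullary using (¬_; Dec; yes; no)
open import Relation.Nullary.Decidable using (¬?)
open import Relation.Binary.PropositionalEquality using (_≡_; _≢_)
open import Relation.Binary.Structures using (IsTotalOrder)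
open import Algebra.Structures using (IsCommutativeRing)

-- The real numbers, axiomatised as a complete ordered field
-- (unique up to isomorphism, so quantifying over all of them is
-- the same as talking about ℝ).

record RealField : Set₁ where
  infixl 6 _+_
  infixl 7 _*_
  infix 4 _≤_
  field
    Carrier : Set
    0# 1#   : Carrier
    _+_ _*_ : Carrier → Carrier → Carrier
    -_      : Carrier → Carrier
    _⁻¹     : Carrier → Carrier
    _≤_     : Carrier → Carrier → Set
    isCommutativeRing : IsCommutativeRing _≡_ _+_ _*_ -_ 0# 1#
    0≢1     : 0# ≢ 1#
    ⁻¹-inverse : ∀ x → x ≢ 0# → x * (x ⁻¹) ≡ 1#
    isTotalOrder : IsTotalOrder _≡_ _≤_
    +-mono-≤ : ∀ {x y} z → x ≤ y → x + z ≤ y + z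
    *-nonneg : ∀ {x y} → 0# ≤ x → 0# ≤ y → 0# ≤ x * y
    complete : (P : Carrier → Set) → ∃ P → (∃ λ b → ∀ x → P x → x ≤ b) →
               ∃ λ s → (∀ x → P x → x ≤ s) × (∀ b → (∀ x → P x → x ≤ b) → s ≤ b)

  _<_ : Carrier → Carrier → Set
  x < y = (x ≤ y) × (x ≢ y)

  total : ∀ x y → (x ≤ y) ⊎ (y ≤ x)
  total = IsTotalOrder.total isTotalOrder

  max : Carrier → Carrier → Carrier
  max x y with total x y
  ... | inj₁ _ = y
  ... | inj₂ _ = x

  ℕ→R : ℕ → Carrier
  ℕ→R zero    = 0#
  ℕ→R (suc k) = 1# + ℕ→R k

  sumTo : ℕ → (ℕ → Carrier) → Carrier
  sumTo zero    f = 0#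
  sumTo (suc m) f = sumTo m f + f m

  sumFin : ∀ {n} → (Fin n → Carrier) → Carrier
  sumFin f = foldr _+_ 0# (map f (allFin _))

  -- maximum of a list (0# for the empty list)
  maxList : List Carrier → Carrier
  maxList []       = 0#
  maxList (x ∷ []) = x
  maxList (x ∷ xs@(_ ∷ _)) = max x (maxList xs)

-- Circular intervals on ℤ_n with n = suc m (n ≥ 1).

ι : ∀ {m} → ℤ → Fin (suc m)
ι {m} x = ℕD._mod_ (x %ℕ suc m) (suc m)

record CInterval (m : ℕ) : Set where
  constructor ⟪_,_⟫
  field
    start : Fin (suc m)
    len   : ℤ
open CInterval public

size : ∀ {m} → CInterval m → ℕ
size I = ∣ len I ∣

-- the k-th element (k < |I|) of the multiset of I
elem : ∀ {m} → CInterval m → ℕ → Fin (suc m)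
elem ⟪ i , + _ ⟫      k = ι (+ toℕ i ℤ.+ + k)
elem ⟪ i , -[1+ _ ] ⟫ k = ι (+ toℕ i ℤ.- + k)

_∈I_ : ∀ {m} → Fin (suc m) → CInterval m → Set
x ∈I I = Any (λ k → elem I k ≡ x) (upTo (size I))

_∈I?_ : ∀ {m} (x : Fin (suc m)) (I : CInterval m) → Dec (x ∈I I)
x ∈I? I = any? (λ k → elem I k ≟F x) (upTo (size I))

-- the edge set I*
star : ∀ {m} → CInterval m → CInterval m
star ⟪ i , + zero ⟫    = ⟪ i , + zero ⟫
star ⟪ i , + (suc k) ⟫ = ⟪ i , + k ⟫
star ⟪ i , -[1+ k ] ⟫  = ⟪ ι (+ toℕ i ℤ.- + 1) , ℤ.- (+ k) ⟫

data Family : Set where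
  cycle path : Family

_∈𝓘_ : ∀ {m} → CInterval m → Family → Set
I ∈𝓘 cycle = Data.Unit.⊤ where import Data.Unit
_∈𝓘_ {m} I path = ¬ (Fin.fromℕ m ∈I star I)

_∈𝓘?_ : ∀ {m} (I : CInterval m) (𝓘 : Family) → Dec (I ∈𝓘 𝓘)
I ∈𝓘? cycle = yes _
_∈𝓘?_ {m} I path = ¬? (Fin.fromℕ m ∈I? star I)

-- all circular intervals with |I| ≤ n  (n = suc m), i.e. d ∈ [-n, n]
boundedIntervals : ∀ m → List (CInterval m)
boundedIntervals m =
  concatMap (λ i → map (λ k → ⟪ i , + k ⟫) (upTo (suc (suc m)))
                ++ map (λ k → ⟪ i , -[1+ k ] ⟫) (upTo (suc m)))
            (allFin (suc m))

module _ (ℝ : RealField) where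
  open RealField ℝ

  -- μ[I] (with multiplicity)
  mass : ∀ {m} → (Fin (suc m) → Carrier) → CInterval m → Carrier
  mass μ I = sumTo (size I) (λ k → μ (elem I k))

  IsProbability : ∀ {m} → (Fin (suc m) → Carrier) → Set
  IsProbability μ = (∀ i → 0# ≤ μ i) × (sumFin μ ≡ 1#)

  relConc : ∀ {m} → Family → (ρ t : Carrier) → (Fin (suc m) → Carrier) → Carrier
  relConc {m} 𝓘 ρ t μ =
    maxList (map (λ I → mass μ I * (max (ρ * ℕ→R (size (star I))) t) ⁻¹)
                 (filter (λ I → I ∈𝓘? 𝓘) (boundedIntervals m)))

{-# OPTIONS --safe #-}
module Submission where

-- Take an interval I attaining R_t(μ). If ρ|I*| ≤ t, then I itself works, since
-- t R_t(μ) = μ[I]. Otherwise choose L with ρ(L-1) ≤ t ≤ ρL and cut I into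
-- consecutive blocks of L vertices followed by one shorter block: there are
-- q + 1 ≤ 2|I*|/L blocks, each with ρ|B*| ≤ t and each again in 𝓘 (its edges
-- are edges of I). The heaviest block carries at least μ[I]/(q+1) ≥ μ[I]·t/(2ρ|I*|)
-- = (t/2)·R_t(μ).

open import Level using (0ℓ)
open import Data.Nat as ℕ using (ℕ; zero; suc; z≤n; s≤s)
import Data.Nat.Properties as ℕP
import Data.Nat.DivMod as ℕD
open import Data.Integer as ℤ using (ℤ; +_; -[1+_]; _%ℕ_; _/ℕ_)
import Data.Integer.Properties as ℤP
import Data.Integer.DivMod as ℤD
open import Data.Integer.Solver using (module +-*-Solver)
open import Data.Fin as Fin using (Fin; toℕ)
import Data.Fin.Properties as FinP
open import Data.List using ([]; _∷_; map; filter)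
open import Data.List.Membership.Propositional using (_∈_)
open import Data.List.Membership.Propositional.Properties using (∈-filter⁻)
open import Data.List.Relation.Unary.Any using (here; there)
import Data.List.Relation.Unary.Any.Properties as AnyP
open import Data.Empty using (⊥-elim)
open import Data.Sum using (_⊎_; inj₁; inj₂; [_,_]′)
open import Data.Product using (Σ; _×_; _,_; proj₂)
open import Relation.Binary.PropositionalEquality
open import Relation.Binary.Bundles using (Poset)
open import Relation.Binary.Structures using (IsTotalOrder)
import Relation.Binary.Reasoning.PartialOrder as PartialOrderReasoning
open import Algebra.Bundles using (CommutativeRing)
import Algebra.Properties.Ring as RingProperties
import Algebra.Solver.Ring.NaturalCoefficients.Default as NaturalCoefficientsSolver
open import Defs

module _ {m : ℕ} where
  private
    n : ℕ
    n = suc m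

  %ℕ-neg : ∀ a → -[1+ a ] %ℕ n ≡ (n ℕ.∸ suc a ℕ.% n) ℕ.% n
  %ℕ-neg a with suc a ℕ.% n | ℕD.m%n<n (suc a) n
  ... | zero  | _  = sym (ℕD.n%n≡0 n)
  ... | suc r | lt = sym (ℕD.m<n⇒m%n≡m (ℕP.∸-monoʳ-< {n} {suc r} {0} (s≤s z≤n) (ℕP.<⇒≤ lt)))

  [x+n]%ℕn≡x%ℕn : ∀ x → (x ℤ.+ + n) %ℕ n ≡ x %ℕ n
  [x+n]%ℕn≡x%ℕn (+ a) = ℕD.[m+n]%n≡m%n a n
  [x+n]%ℕn≡x%ℕn -[1+ a ] with ℕP.≤-<-connex (suc a) n
  ... | inj₁ 1+a≤n rewrite ℤP.⊖-≥ 1+a≤n | %ℕ-neg a with ℕP.m≤n⇒m<n∨m≡n 1+a≤n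
  ...   | inj₁ 1+a<n rewrite ℕD.m<n⇒m%n≡m 1+a<n = refl
  ...   | inj₂ refl = begin
    (n ℕ.∸ n) ℕ.% n                ≡⟨ cong (ℕ._% n) (ℕP.n∸n≡0 n) ⟩
    0                              ≡⟨ ℕD.n%n≡0 n ⟨
    (n ℕ.∸ 0) ℕ.% n                ≡⟨ cong (λ z → (n ℕ.∸ z) ℕ.% n) (ℕD.n%n≡0 n) ⟨
    (n ℕ.∸ n ℕ.% n) ℕ.% n          ∎
    where open ≡-Reasoning
  [x+n]%ℕn≡x%ℕn -[1+ a ] | inj₂ n<1+a rewrite ℤP.⊖-< n<1+a = go (a ℕ.∸ m) refl
    where
    go : ∀ j → a ℕ.∸ m ≡ j → (ℤ.- (+ j)) %ℕ n ≡ -[1+ a ] %ℕ n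
    go zero    a∸m≡0 = ⊥-elim (ℕP.<⇒≱ n<1+a (s≤s (ℕP.m∸n≡0⇒m≤n a∸m≡0)))
    go (suc k) a∸m≡j = begin
      -[1+ k ] %ℕ n                    ≡⟨ %ℕ-neg k ⟩
      (n ℕ.∸ suc k ℕ.% n) ℕ.% n        ≡⟨ cong (λ z → (n ℕ.∸ z) ℕ.% n) [1+a]%n≡[1+k]%n ⟨
      (n ℕ.∸ suc a ℕ.% n) ℕ.% n        ≡⟨ %ℕ-neg a ⟨
      -[1+ a ] %ℕ n                    ∎
      where
      open ≡-Reasoning
      a≡1+k+m : a ≡ suc k ℕ.+ m
      a≡1+k+m = trans (sym (ℕP.m∸n+n≡m (ℕP.≤-pred (ℕP.<⇒≤ n<1+a)))) (cong (ℕ._+ m) a∸m≡j)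
      [1+a]%n≡[1+k]%n : suc a ℕ.% n ≡ suc k ℕ.% n
      [1+a]%n≡[1+k]%n = trans (cong (λ z → suc z ℕ.% n) (trans a≡1+k+m (sym (ℕP.+-suc k m))))
                              (ℕD.[m+n]%n≡m%n (suc k) n)

  [x+kn]%ℕn≡x%ℕn : ∀ x k → (x ℤ.+ + (k ℕ.* n)) %ℕ n ≡ x %ℕ n
  [x+kn]%ℕn≡x%ℕn x zero    = cong (_%ℕ n) (ℤP.+-identityʳ x)
  [x+kn]%ℕn≡x%ℕn x (suc k) = begin
    (x ℤ.+ + (n ℕ.+ k ℕ.* n)) %ℕ n      ≡⟨ cong (_%ℕ n) regroup ⟩
    ((x ℤ.+ + (k ℕ.* n)) ℤ.+ + n) %ℕ n  ≡⟨ [x+n]%ℕn≡x%ℕn (x ℤ.+ + (k ℕ.* n)) ⟩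
    (x ℤ.+ + (k ℕ.* n)) %ℕ n            ≡⟨ [x+kn]%ℕn≡x%ℕn x k ⟩
    x %ℕ n                              ∎
    where
    open ≡-Reasoning
    open +-*-Solver
    regroup : x ℤ.+ + (n ℕ.+ k ℕ.* n) ≡ (x ℤ.+ + (k ℕ.* n)) ℤ.+ + n
    regroup = trans (cong (λ z → x ℤ.+ z) (ℤP.pos-+ n (k ℕ.* n)))
                    (solve 3 (λ X N K → X :+ (N :+ K) := (X :+ K) :+ N) refl x (+ n) (+ (k ℕ.* n)))

  [x-kn]%ℕn≡x%ℕn : ∀ x k → (x ℤ.- + (k ℕ.* n)) %ℕ n ≡ x %ℕ n
  [x-kn]%ℕn≡x%ℕn x k = trans (sym ([x+kn]%ℕn≡x%ℕn (x ℤ.- + k*n) k)) (cong (_%ℕ n) x-y+y≡x)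
    where
    open +-*-Solver
    k*n = k ℕ.* n
    x-y+y≡x : (x ℤ.- + k*n) ℤ.+ + k*n ≡ x
    x-y+y≡x = solve 2 (λ X Y → (X :- Y) :+ Y := X) refl x (+ k*n)

  [x+qn]%ℕn≡x%ℕn : ∀ x q → (x ℤ.+ q ℤ.* + n) %ℕ n ≡ x %ℕ n
  [x+qn]%ℕn≡x%ℕn x (+ k) =
    trans (cong (λ z → (x ℤ.+ z) %ℕ n) (sym (ℤP.pos-* k n))) ([x+kn]%ℕn≡x%ℕn x k)
  [x+qn]%ℕn≡x%ℕn x -[1+ k ] =
    trans (cong (λ z → (x ℤ.+ z) %ℕ n) -[1+k]*n≡-[[1+k]*n]) ([x-kn]%ℕn≡x%ℕn x (suc k))
    where
    -[1+k]*n≡-[[1+k]*n] : -[1+ k ] ℤ.* + n ≡ ℤ.- + (suc k ℕ.* n)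
    -[1+k]*n≡-[[1+k]*n] =
      trans (sym (ℤP.neg-distribˡ-* (+ suc k) (+ n))) (cong ℤ.-_ (sym (ℤP.pos-* (suc k) n)))

  toℕ-ι : ∀ x → toℕ (ι {m} x) ≡ x %ℕ n
  toℕ-ι x = trans (FinP.toℕ-fromℕ< _) (ℕD.m<n⇒m%n≡m (ℤD.n%ℕd<d x n))

  ι-toℕ-+ : ∀ x y → ι {m} (+ toℕ (ι {m} x) ℤ.+ y) ≡ ι {m} (x ℤ.+ y)
  ι-toℕ-+ x y = cong (ℕD._mod n) (begin
    (+ toℕ (ι {m} x) ℤ.+ y) %ℕ n                  ≡⟨ cong (λ z → (+ z ℤ.+ y) %ℕ n) (toℕ-ι x) ⟩
    (+ r ℤ.+ y) %ℕ n                              ≡⟨ [x+qn]%ℕn≡x%ℕn (+ r ℤ.+ y) q ⟨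
    ((+ r ℤ.+ y) ℤ.+ q ℤ.* + n) %ℕ n              ≡⟨ cong (_%ℕ n) division ⟨
    (x ℤ.+ y) %ℕ n                                ∎)
    where
    open ≡-Reasoning
    open +-*-Solver
    r = x %ℕ n
    q = x /ℕ n
    division : x ℤ.+ y ≡ (+ r ℤ.+ y) ℤ.+ q ℤ.* + n
    division = trans (cong (ℤ._+ y) (ℤD.a≡a%ℕn+[a/ℕn]*n x n))
                     (solve 3 (λ R Q Y → (R :+ Q :* N) :+ Y := (R :+ Y) :+ Q :* N) refl (+ r) q y)
      where N = con (+ n)

module _ {m : ℕ} where

  -- subinterval I a l consists of the elements a, a+1, …, a+l of I, in the direction of I.
  subinterval : CInterval m → ℕ → ℕ → CInterval m
  subinterval ⟪ i , + _ ⟫      a l = ⟪ ι (+ toℕ i ℤ.+ + a) , + suc l ⟫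
  subinterval ⟪ i , -[1+ _ ] ⟫ a l = ⟪ ι (+ toℕ i ℤ.- + a) , -[1+ l ] ⟫

  size-star-subinterval : ∀ I a l → size (star (subinterval I a l)) ≡ l
  size-star-subinterval ⟪ i , + _ ⟫      a l = refl
  size-star-subinterval ⟪ i , -[1+ _ ] ⟫ a l = ℤP.∣-i∣≡∣i∣ (+ l)

  size≡suc-size-star : ∀ (I : CInterval m) → 0 ℕ.< size (star I) → size I ≡ suc (size (star I))
  size≡suc-size-star ⟪ i , + suc _ ⟫  _ = refl
  size≡suc-size-star ⟪ i , -[1+ k ] ⟫ _ = cong suc (sym (ℤP.∣-i∣≡∣i∣ (+ k)))

  elem-subinterval : ∀ I a l k → elem (subinterval I a l) k ≡ elem I (a ℕ.+ k)
  elem-subinterval ⟪ i , + _ ⟫ a l k = begin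
    ι (+ toℕ (ι {m} (+ toℕ i ℤ.+ + a)) ℤ.+ + k)   ≡⟨ ι-toℕ-+ (+ toℕ i ℤ.+ + a) (+ k) ⟩
    ι ((+ toℕ i ℤ.+ + a) ℤ.+ + k)                 ≡⟨ cong ι (ℤP.+-assoc (+ toℕ i) (+ a) (+ k)) ⟩
    ι (+ toℕ i ℤ.+ + (a ℕ.+ k))                   ∎
    where open ≡-Reasoning
  elem-subinterval ⟪ i , -[1+ _ ] ⟫ a l k = begin
    ι (+ toℕ (ι {m} (+ toℕ i ℤ.- + a)) ℤ.- + k)   ≡⟨ ι-toℕ-+ (+ toℕ i ℤ.- + a) (ℤ.- + k) ⟩
    ι ((+ toℕ i ℤ.- + a) ℤ.- + k)                 ≡⟨ cong ι (regroup (+ toℕ i)) ⟩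
    ι (+ toℕ i ℤ.- + (a ℕ.+ k))                   ∎
    where
    open ≡-Reasoning
    open +-*-Solver
    regroup : ∀ x → (x ℤ.- + a) ℤ.- + k ≡ x ℤ.- + (a ℕ.+ k)
    regroup x = trans (solve 3 (λ X A K → (X :- A) :- K := X :- (A :+ K)) refl x (+ a) (+ k))
                      (cong (λ z → x ℤ.- z) (sym (ℤP.pos-+ a k)))

  elem-star-subinterval : ∀ I a l k → k ℕ.< l → a ℕ.+ k ℕ.< size (star I) →
                          elem (star (subinterval I a l)) k ≡ elem (star I) (a ℕ.+ k)
  elem-star-subinterval ⟪ i , + zero ⟫ a l k _ ()
  -- The elements of a forward interval do not depend on its length.
  elem-star-subinterval ⟪ i , + suc _ ⟫ a l k _ _ = elem-subinterval ⟪ i , + 0 ⟫ a l k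
  elem-star-subinterval ⟪ i , -[1+ zero ] ⟫ a l k _ ()
  elem-star-subinterval ⟪ i , -[1+ suc _ ] ⟫ a (suc l) k _ _ = begin
    ι (+ toℕ (ι {m} (+ toℕ (ι {m} (+ toℕ i ℤ.- + a)) ℤ.- + 1)) ℤ.- + k)
      ≡⟨ ι-toℕ-+ (+ toℕ (ι {m} (+ toℕ i ℤ.- + a)) ℤ.- + 1) (ℤ.- + k) ⟩
    ι ((+ toℕ (ι {m} (+ toℕ i ℤ.- + a)) ℤ.- + 1) ℤ.- + k)
      ≡⟨ cong ι (ℤP.+-assoc (+ toℕ (ι {m} (+ toℕ i ℤ.- + a))) (ℤ.- + 1) (ℤ.- + k)) ⟩
    ι (+ toℕ (ι {m} (+ toℕ i ℤ.- + a)) ℤ.+ (ℤ.- + 1 ℤ.- + k))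
      ≡⟨ ι-toℕ-+ (+ toℕ i ℤ.- + a) (ℤ.- + 1 ℤ.- + k) ⟩
    ι ((+ toℕ i ℤ.- + a) ℤ.+ (ℤ.- + 1 ℤ.- + k))
      ≡⟨ cong ι (regroup (+ toℕ i)) ⟩
    ι ((+ toℕ i ℤ.- + 1) ℤ.- + (a ℕ.+ k))
      ≡⟨ ι-toℕ-+ (+ toℕ i ℤ.- + 1) (ℤ.- + (a ℕ.+ k)) ⟨
    ι (+ toℕ (ι {m} (+ toℕ i ℤ.- + 1)) ℤ.- + (a ℕ.+ k))
      ∎
    where
    open ≡-Reasoning
    open +-*-Solver
    regroup : ∀ x → (x ℤ.- + a) ℤ.+ (ℤ.- + 1 ℤ.- + k) ≡ (x ℤ.- + 1) ℤ.- + (a ℕ.+ k)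
    regroup x =
      trans (solve 4 (λ X A O K → (X :- A) :+ (:- O :- K) := (X :- O) :- (A :+ K)) refl x (+ a) (+ 1) (+ k))
            (cong (λ z → (x ℤ.- + 1) ℤ.- z) (sym (ℤP.pos-+ a k)))

  star-subinterval-⊆ : ∀ I a l → a ℕ.+ l ℕ.≤ size (star I) →
                       ∀ x → x ∈I star (subinterval I a l) → x ∈I star I
  star-subinterval-⊆ I a l a+l≤ x x∈ with AnyP.applyUpTo⁻ (λ k → k) x∈
  ... | k , k<size , eq =
    AnyP.applyUpTo⁺ (λ k → k) (trans (sym (elem-star-subinterval I a l k k<l a+k<)) eq) a+k<
    where
    k<l : k ℕ.< l
    k<l = subst (k ℕ.<_) (size-star-subinterval I a l) k<size
    a+k< : a ℕ.+ k ℕ.< size (star I)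
    a+k< = ℕP.<-≤-trans (ℕP.+-monoʳ-< a k<l) a+l≤

  empty-interval : CInterval m
  empty-interval = ⟪ Fin.zero , + 0 ⟫

  empty-interval-∈𝓘 : ∀ 𝓘 → empty-interval ∈𝓘 𝓘
  empty-interval-∈𝓘 cycle = _
  empty-interval-∈𝓘 path  = λ ()

  subinterval-∈𝓘 : ∀ 𝓘 I a l → a ℕ.+ l ℕ.≤ size (star I) →
                   I ∈𝓘 𝓘 → subinterval I a l ∈𝓘 𝓘
  subinterval-∈𝓘 cycle I a l _    _   = _
  subinterval-∈𝓘 path  I a l a+l≤ I∈𝓘 = λ n-1∈ → I∈𝓘 (star-subinterval-⊆ I a l a+l≤ _ n-1∈)

module OrderedFieldProperties (ℝ : RealField) where
  open RealField ℝ

  commutativeRing : CommutativeRing 0ℓ 0ℓ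
  commutativeRing = record { isCommutativeRing = isCommutativeRing }

  open CommutativeRing commutativeRing public
    using (+-assoc; +-comm; +-identityˡ; +-identityʳ; *-assoc; *-comm; *-identityˡ; zeroˡ; zeroʳ)
  open CommutativeRing commutativeRing using (-‿inverseˡ; -‿inverseʳ)
  open RingProperties (CommutativeRing.ring commutativeRing) using (-‿distribˡ-*; -‿involutive; [y-z]x≈yx-zx)
  open NaturalCoefficientsSolver (CommutativeRing.commutativeSemiring commutativeRing) public

  ≤-poset : Poset 0ℓ 0ℓ 0ℓ
  ≤-poset = record { isPartialOrder = IsTotalOrder.isPartialOrder isTotalOrder }

  open Poset ≤-poset public using ()
    renaming (refl to ≤-refl; reflexive to ≤-reflexive; trans to ≤-trans; antisym to ≤-antisym)
  module ≤-Reasoning = PartialOrderReasoning ≤-poset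
  open ≤-Reasoning

  +-mono₂-≤ : ∀ {a b c d} → a ≤ b → c ≤ d → a + c ≤ b + d
  +-mono₂-≤ {a} {b} {c} {d} a≤b c≤d = begin
    a + c  ≤⟨ +-mono-≤ c a≤b ⟩
    b + c  ≡⟨ +-comm b c ⟩
    c + b  ≤⟨ +-mono-≤ b c≤d ⟩
    d + b  ≡⟨ +-comm d b ⟩
    b + d  ∎

  x≤y⇒0≤y-x : ∀ {x y} → x ≤ y → 0# ≤ y + - x
  x≤y⇒0≤y-x {x} {y} x≤y = begin
    0#       ≡⟨ -‿inverseʳ x ⟨
    x + - x  ≤⟨ +-mono-≤ (- x) x≤y ⟩
    y + - x  ∎

  0≤y-x⇒x≤y : ∀ {x y} → 0# ≤ y + - x → x ≤ y
  0≤y-x⇒x≤y {x} {y} 0≤y-x = begin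
    x              ≡⟨ +-identityˡ x ⟨
    0# + x         ≤⟨ +-mono-≤ x 0≤y-x ⟩
    y + - x + x    ≡⟨ +-assoc y (- x) x ⟩
    y + (- x + x)  ≡⟨ cong (λ z → y + z) (-‿inverseˡ x) ⟩
    y + 0#         ≡⟨ +-identityʳ y ⟩
    y              ∎

  *-monoʳ-≤ : ∀ {x y z} → 0# ≤ z → x ≤ y → x * z ≤ y * z
  *-monoʳ-≤ {x} {y} {z} 0≤z x≤y =
    0≤y-x⇒x≤y (≤-trans (*-nonneg (x≤y⇒0≤y-x x≤y) 0≤z) (≤-reflexive ([y-z]x≈yx-zx z y x)))

  *-monoˡ-≤ : ∀ {x y z} → 0# ≤ z → x ≤ y → z * x ≤ z * y
  *-monoˡ-≤ {x} {y} {z} 0≤z x≤y = begin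
    z * x  ≡⟨ *-comm z x ⟩
    x * z  ≤⟨ *-monoʳ-≤ 0≤z x≤y ⟩
    y * z  ≡⟨ *-comm y z ⟩
    z * y  ∎

  0≤1 : 0# ≤ 1#
  0≤1 with total 0# 1#
  ... | inj₁ 0≤1 = 0≤1
  ... | inj₂ 1≤0 = begin
    0#             ≤⟨ *-nonneg 0≤-1 0≤-1 ⟩
    - 1# * - 1#    ≡⟨ -‿distribˡ-* 1# (- 1#) ⟨
    - (1# * - 1#)  ≡⟨ cong -_ (*-identityˡ (- 1#)) ⟩
    - - 1#         ≡⟨ -‿involutive 1# ⟩
    1#             ∎
    where
    0≤-1 : 0# ≤ - 1#
    0≤-1 = ≤-trans (x≤y⇒0≤y-x 1≤0) (≤-reflexive (+-identityˡ (- 1#)))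

  0≤ℕ→R : ∀ k → 0# ≤ ℕ→R k
  0≤ℕ→R zero    = ≤-refl
  0≤ℕ→R (suc k) = ≤-trans (≤-reflexive (sym (+-identityˡ 0#))) (+-mono₂-≤ 0≤1 (0≤ℕ→R k))

  ℕ→R-+ : ∀ a b → ℕ→R (a ℕ.+ b) ≡ ℕ→R a + ℕ→R b
  ℕ→R-+ zero    b = sym (+-identityˡ _)
  ℕ→R-+ (suc a) b = trans (cong (λ z → 1# + z) (ℕ→R-+ a b)) (sym (+-assoc 1# (ℕ→R a) (ℕ→R b)))

  ℕ→R-* : ∀ a b → ℕ→R (a ℕ.* b) ≡ ℕ→R a * ℕ→R b
  ℕ→R-* zero    b = sym (zeroˡ _)
  ℕ→R-* (suc a) b = begin-equality
    ℕ→R (b ℕ.+ a ℕ.* b)        ≡⟨ ℕ→R-+ b (a ℕ.* b) ⟩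
    ℕ→R b + ℕ→R (a ℕ.* b)      ≡⟨ cong (λ z → ℕ→R b + z) (ℕ→R-* a b) ⟩
    ℕ→R b + ℕ→R a * ℕ→R b      ≡⟨ solve 2 (λ A B → B :+ A :* B := (con 1 :+ A) :* B) refl _ _ ⟩
    (1# + ℕ→R a) * ℕ→R b       ∎

  ℕ→R-mono : ∀ {a b} → a ℕ.≤ b → ℕ→R a ≤ ℕ→R b
  ℕ→R-mono {a} {b} a≤b = begin
    ℕ→R a                      ≡⟨ +-identityʳ _ ⟨
    ℕ→R a + 0#                 ≤⟨ +-mono₂-≤ ≤-refl (0≤ℕ→R (b ℕ.∸ a)) ⟩
    ℕ→R a + ℕ→R (b ℕ.∸ a)      ≡⟨ ℕ→R-+ a (b ℕ.∸ a) ⟨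
    ℕ→R (a ℕ.+ (b ℕ.∸ a))      ≡⟨ cong ℕ→R (ℕP.m+[n∸m]≡n a≤b) ⟩
    ℕ→R b                      ∎

  0≤x⁻¹ : ∀ {x} → 0# ≤ x → x ≢ 0# → 0# ≤ x ⁻¹
  0≤x⁻¹ {x} 0≤x x≢0 with total 0# (x ⁻¹)
  ... | inj₁ 0≤x⁻¹ = 0≤x⁻¹
  ... | inj₂ x⁻¹≤0 = ⊥-elim (0≢1 (≤-antisym 0≤1 (begin
    1#           ≡⟨ ⁻¹-inverse x x≢0 ⟨
    x * x ⁻¹     ≡⟨ *-comm x (x ⁻¹) ⟩
    x ⁻¹ * x     ≤⟨ *-monoʳ-≤ 0≤x x⁻¹≤0 ⟩
    0# * x       ≡⟨ zeroˡ x ⟩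
    0#           ∎)))

  two : Carrier
  two = 1# + 1#

  two≢0 : two ≢ 0#
  two≢0 two≡0 = 0≢1 (≤-antisym 0≤1 (begin
    1#        ≡⟨ +-identityʳ 1# ⟨
    1# + 0#   ≤⟨ +-mono₂-≤ ≤-refl 0≤1 ⟩
    two       ≡⟨ two≡0 ⟩
    0#        ∎))

  half : Carrier
  half = two ⁻¹

  0≤half : 0# ≤ half
  0≤half = 0≤x⁻¹ (≤-trans (≤-reflexive (sym (+-identityˡ 0#))) (+-mono₂-≤ 0≤1 0≤1)) two≢0

  max-of-≤ : ∀ {x y} → x ≤ y → max x y ≡ y
  max-of-≤ {x} {y} x≤y with total x y
  ... | inj₁ _   = refl
  ... | inj₂ y≤x = ≤-antisym x≤y y≤x

  max-of-≥ : ∀ {x y} → y ≤ x → max x y ≡ x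
  max-of-≥ {x} {y} y≤x with total x y
  ... | inj₁ x≤y = ≤-antisym y≤x x≤y
  ... | inj₂ _   = refl

  sumTo-cong : ∀ a {f g : ℕ → Carrier} → (∀ k → f k ≡ g k) → sumTo a f ≡ sumTo a g
  sumTo-cong zero    f≡g = refl
  sumTo-cong (suc a) f≡g = cong₂ _+_ (sumTo-cong a f≡g) (f≡g a)

  sumTo-+ : ∀ a b (f : ℕ → Carrier) → sumTo (a ℕ.+ b) f ≡ sumTo a f + sumTo b (λ k → f (a ℕ.+ k))
  sumTo-+ a zero    f rewrite ℕP.+-identityʳ a = sym (+-identityʳ _)
  sumTo-+ a (suc b) f rewrite ℕP.+-suc a b =
    trans (cong (_+ f (a ℕ.+ b)) (sumTo-+ a b f)) (+-assoc (sumTo a f) _ _)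

  sumTo-blocks : ∀ p L (f : ℕ → Carrier) →
                 sumTo (p ℕ.* L) f ≡ sumTo p (λ j → sumTo L (λ k → f (j ℕ.* L ℕ.+ k)))
  sumTo-blocks zero    L f = refl
  sumTo-blocks (suc p) L f = begin-equality
    sumTo (L ℕ.+ p ℕ.* L) f                    ≡⟨ cong (λ z → sumTo z f) (ℕP.+-comm L (p ℕ.* L)) ⟩
    sumTo (p ℕ.* L ℕ.+ L) f                    ≡⟨ sumTo-+ (p ℕ.* L) L f ⟩
    sumTo (p ℕ.* L) f + block p                ≡⟨ cong (_+ block p) (sumTo-blocks p L f) ⟩
    sumTo p block + block p                    ∎
    where
    block : ℕ → Carrier
    block j = sumTo L (λ k → f (j ℕ.* L ℕ.+ k))

  sumTo-nonneg : ∀ a (f : ℕ → Carrier) → (∀ k → 0# ≤ f k) → 0# ≤ sumTo a f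
  sumTo-nonneg zero    f 0≤f = ≤-refl
  sumTo-nonneg (suc a) f 0≤f =
    ≤-trans (≤-reflexive (sym (+-identityˡ 0#))) (+-mono₂-≤ (sumTo-nonneg a f 0≤f) (0≤f a))

  x≤Nz⇒y≤z⇒x+y≤[1+N]z : ∀ {x y z} N → x ≤ N * z → y ≤ z → x + y ≤ (1# + N) * z
  x≤Nz⇒y≤z⇒x+y≤[1+N]z {x} {y} {z} N x≤Nz y≤z = begin
    x + y          ≤⟨ +-mono₂-≤ x≤Nz y≤z ⟩
    N * z + z      ≡⟨ solve 2 (λ N Z → N :* Z :+ Z := (con 1 :+ N) :* Z) refl N z ⟩
    (1# + N) * z   ∎

  ∃-above-average : ∀ {A : Set} (w : A → Carrier) (P : A → Set) (x : A) (xs : ℕ → A) q →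
                    P x → (∀ j → j ℕ.< q → P (xs j)) →
                    Σ A λ y → P y × w x + sumTo q (λ j → w (xs j)) ≤ ℕ→R (suc q) * w y
  ∃-above-average w P x xs zero Px _ = x , Px , ≤-reflexive (begin-equality
    w x + 0#          ≡⟨ solve 1 (λ X → X :+ con 0 := (con 1 :+ con 0) :* X) refl (w x) ⟩
    (1# + 0#) * w x   ∎)
  ∃-above-average w P x xs (suc q) Px Pxs
    with ∃-above-average w P x xs q Px (λ j j<q → Pxs j (ℕP.m≤n⇒m≤1+n j<q))
  ... | y , Py , below-y with total (w y) (w (xs q))
  ...   | inj₁ wy≤wxq = xs q , Pxs q ℕP.≤-refl , ≤-trans (≤-reflexive (sym (+-assoc _ _ _)))
    (x≤Nz⇒y≤z⇒x+y≤[1+N]z _ (≤-trans below-y (*-monoˡ-≤ (0≤ℕ→R (suc q)) wy≤wxq)) ≤-refl)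
  ...   | inj₂ wxq≤wy = y , Py , ≤-trans (≤-reflexive (sym (+-assoc _ _ _)))
    (x≤Nz⇒y≤z⇒x+y≤[1+N]z _ below-y wxq≤wy)

  ∃-crossing : (g : ℕ → Carrier) (t : Carrier) (s : ℕ) → g 0 ≤ t → t ≤ g (suc s) →
               Σ ℕ λ k → k ℕ.≤ s × g k ≤ t × t ≤ g (suc k)
  ∃-crossing g t zero    g0≤t t≤g1 = 0 , z≤n , g0≤t , t≤g1
  ∃-crossing g t (suc s) g0≤t t≤g[2+s] with total (g (suc s)) t
  ... | inj₁ g[1+s]≤t = suc s , ℕP.≤-refl , g[1+s]≤t , t≤g[2+s]
  ... | inj₂ t≤g[1+s] with ∃-crossing g t s g0≤t t≤g[1+s]
  ...   | k , k≤s , gk≤t , t≤g[1+k] = k , ℕP.m≤n⇒m≤1+n k≤s , gk≤t , t≤g[1+k]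

  -- The first alternative is the junk value maxList [] = 0#.
  maxList-attained : ∀ {A : Set} (f : A → Carrier) xs →
                     maxList (map f xs) ≡ 0# ⊎ Σ A (λ x → x ∈ xs × maxList (map f xs) ≡ f x)
  maxList-attained f []           = inj₁ refl
  maxList-attained f (x ∷ [])     = inj₂ (x , here refl , refl)
  maxList-attained f (x ∷ y ∷ ys) with total (f x) (maxList (map f (y ∷ ys))) | maxList-attained f (y ∷ ys)
  ... | inj₁ _ | inj₁ max≡0              = inj₁ max≡0
  ... | inj₁ _ | inj₂ (z , z∈ , max≡fz) = inj₂ (z , there z∈ , max≡fz)
  ... | inj₂ _ | _                      = inj₂ (x , here refl , refl)

  half*t*[a/s]≤b : ∀ {a b s t} N → 0# ≤ t → 0# ≤ b → 0# ≤ s → s ≢ 0# →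
                   a ≤ N * b → t * N ≤ two * s → half * t * (a * s ⁻¹) ≤ b
  half*t*[a/s]≤b {a} {b} {s} {t} N 0≤t 0≤b 0≤s s≢0 a≤Nb tN≤2s = begin
    half * t * (a * s ⁻¹)
      ≡⟨ solve 4 (λ H T A S → H :* T :* (A :* S) := H :* T :* S :* A) refl half t a (s ⁻¹) ⟩
    half * t * s ⁻¹ * a
      ≤⟨ *-monoˡ-≤ (*-nonneg (*-nonneg 0≤half 0≤t) 0≤s⁻¹) a≤Nb ⟩
    half * t * s ⁻¹ * (N * b)
      ≡⟨ solve 5 (λ H T S N B → H :* T :* S :* (N :* B) := T :* N :* (H :* S :* B)) refl half t (s ⁻¹) N b ⟩
    t * N * (half * s ⁻¹ * b)
      ≤⟨ *-monoʳ-≤ (*-nonneg (*-nonneg 0≤half 0≤s⁻¹) 0≤b) tN≤2s ⟩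
    two * s * (half * s ⁻¹ * b)
      ≡⟨ solve 5 (λ W S H I B → W :* S :* (H :* I :* B) := W :* H :* (S :* I) :* B) refl two s half (s ⁻¹) b ⟩
    two * half * (s * s ⁻¹) * b
      ≡⟨ cong₂ (λ u v → u * v * b) (⁻¹-inverse two two≢0) (⁻¹-inverse s s≢0) ⟩
    1# * 1# * b
      ≡⟨ solve 1 (λ B → con 1 :* con 1 :* B := B) refl b ⟩
    b ∎
    where
    0≤s⁻¹ : 0# ≤ s ⁻¹
    0≤s⁻¹ = 0≤x⁻¹ 0≤s s≢0

L*[1+q]≤2*[r+q*L] : ∀ L q r → L ℕ.≤ r ℕ.+ q ℕ.* L →
                    L ℕ.* suc q ℕ.≤ (r ℕ.+ q ℕ.* L) ℕ.+ (r ℕ.+ q ℕ.* L)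
L*[1+q]≤2*[r+q*L] L q r L≤s = begin
  L ℕ.* suc q                          ≡⟨ ℕP.*-suc L q ⟩
  L ℕ.+ L ℕ.* q                        ≡⟨ cong (L ℕ.+_) (ℕP.*-comm L q) ⟩
  L ℕ.+ q ℕ.* L                        ≤⟨ ℕP.+-mono-≤ L≤s (ℕP.m≤n+m (q ℕ.* L) r) ⟩
  (r ℕ.+ q ℕ.* L) ℕ.+ (r ℕ.+ q ℕ.* L)  ∎
  where open ℕP.≤-Reasoning

module Concentration (ℝ : RealField) {m : ℕ} (μ : Fin (suc m) → RealField.Carrier ℝ)
                     (μ≥0 : ∀ i → RealField._≤_ ℝ (RealField.0# ℝ) (μ i)) where
  open RealField ℝ
  open OrderedFieldProperties ℝ

  mass-nonneg : ∀ I → 0# ≤ mass ℝ μ I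
  mass-nonneg I = sumTo-nonneg (size I) _ (λ k → μ≥0 _)

  mass-subinterval : ∀ I a l →
                     mass ℝ μ (subinterval I a l) ≡ sumTo (suc l) (λ k → μ (elem I (a ℕ.+ k)))
  mass-subinterval I@(⟪ _ , + _ ⟫)      a l = sumTo-cong (suc l) (λ k → cong μ (elem-subinterval I a l k))
  mass-subinterval I@(⟪ _ , -[1+ _ ] ⟫) a l = sumTo-cong (suc l) (λ k → cong μ (elem-subinterval I a l k))

  ∃-heavy-piece : ∀ 𝓘 I → I ∈𝓘 𝓘 → size I ≡ suc (size (star I)) →
                  ∀ L' q r → size (star I) ≡ r ℕ.+ q ℕ.* suc L' → r ℕ.≤ L' →
                  Σ (CInterval m) λ P → (P ∈𝓘 𝓘 × size (star P) ℕ.≤ L') ×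
                    mass ℝ μ I ≤ ℕ→R (suc q) * mass ℝ μ P
  ∃-heavy-piece 𝓘 I I∈𝓘 size≡ L' q r size*≡ r≤L' =
    let P , P-good , average≤ = ∃-above-average (mass ℝ μ) Good tail block q tail-good block-good
    in  P , P-good , ≤-trans (≤-reflexive decomposition) average≤
    where
    L = suc L'
    block : ℕ → CInterval m
    block j = subinterval I (j ℕ.* L) L'
    tail : CInterval m
    tail = subinterval I (q ℕ.* L) r
    Good : CInterval m → Set
    Good P = P ∈𝓘 𝓘 × size (star P) ℕ.≤ L'

    tail-good : Good tail
    tail-good = subinterval-∈𝓘 𝓘 I (q ℕ.* L) r qL+r≤ I∈𝓘
              , ℕP.≤-trans (ℕP.≤-reflexive (size-star-subinterval I (q ℕ.* L) r)) r≤L'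
      where
      qL+r≤ : q ℕ.* L ℕ.+ r ℕ.≤ size (star I)
      qL+r≤ = ℕP.≤-reflexive (trans (ℕP.+-comm (q ℕ.* L) r) (sym size*≡))

    block-good : ∀ j → j ℕ.< q → Good (block j)
    block-good j j<q = subinterval-∈𝓘 𝓘 I (j ℕ.* L) L' jL+L'≤ I∈𝓘
                     , ℕP.≤-reflexive (size-star-subinterval I (j ℕ.* L) L')
      where
      open ℕP.≤-Reasoning
      jL+L'≤ : j ℕ.* L ℕ.+ L' ℕ.≤ size (star I)
      jL+L'≤ = begin
        j ℕ.* L ℕ.+ L'   ≤⟨ ℕP.+-monoʳ-≤ (j ℕ.* L) (ℕP.n≤1+n L') ⟩
        j ℕ.* L ℕ.+ L    ≡⟨ ℕP.+-comm (j ℕ.* L) L ⟩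
        suc j ℕ.* L      ≤⟨ ℕP.*-monoˡ-≤ L j<q ⟩
        q ℕ.* L          ≤⟨ ℕP.m≤n+m (q ℕ.* L) r ⟩
        r ℕ.+ q ℕ.* L    ≡⟨ size*≡ ⟨
        size (star I)    ∎

    size≡qL+[1+r] : size I ≡ q ℕ.* L ℕ.+ suc r
    size≡qL+[1+r] = begin
      size I                  ≡⟨ size≡ ⟩
      suc (size (star I))     ≡⟨ cong suc size*≡ ⟩
      suc (r ℕ.+ q ℕ.* L)     ≡⟨ cong suc (ℕP.+-comm r (q ℕ.* L)) ⟩
      suc (q ℕ.* L ℕ.+ r)     ≡⟨ ℕP.+-suc (q ℕ.* L) r ⟨
      q ℕ.* L ℕ.+ suc r       ∎
      where open ≡-Reasoning

    F : ℕ → Carrier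
    F k = μ (elem I k)

    decomposition : mass ℝ μ I ≡ mass ℝ μ tail + sumTo q (λ j → mass ℝ μ (block j))
    decomposition = begin
      sumTo (size I) F
        ≡⟨ cong (λ z → sumTo z F) size≡qL+[1+r] ⟩
      sumTo (q ℕ.* L ℕ.+ suc r) F
        ≡⟨ sumTo-+ (q ℕ.* L) (suc r) F ⟩
      sumTo (q ℕ.* L) F + sumTo (suc r) (λ k → F (q ℕ.* L ℕ.+ k))
        ≡⟨ cong₂ _+_ (sumTo-blocks q L F) (sym (mass-subinterval I (q ℕ.* L) r)) ⟩
      sumTo q (λ j → sumTo L (λ k → F (j ℕ.* L ℕ.+ k))) + mass ℝ μ tail
        ≡⟨ cong (_+ mass ℝ μ tail) (sumTo-cong q (λ j → sym (mass-subinterval I (j ℕ.* L) L'))) ⟩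
      sumTo q (λ j → mass ℝ μ (block j)) + mass ℝ μ tail
        ≡⟨ +-comm _ _ ⟩
      mass ℝ μ tail + sumTo q (λ j → mass ℝ μ (block j))
        ∎
      where open ≡-Reasoning

  module _ (𝓘 : Family) {ρ t : Carrier} (0≤ρ : 0# ≤ ρ) (0≤t : 0# ≤ t) (0≢t : 0# ≢ t) where

    ρ0≤t : ρ * ℕ→R 0 ≤ t
    ρ0≤t = ≤-trans (≤-reflexive (zeroʳ ρ)) 0≤t

    concentration : CInterval m → Carrier
    concentration I = mass ℝ μ I * (max (ρ * ℕ→R (size (star I))) t) ⁻¹

    half*t*concentration≤mass : ∀ I → ρ * ℕ→R (size (star I)) ≤ t →
                                half * t * concentration I ≤ mass ℝ μ I
    half*t*concentration≤mass I ρs≤t = begin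
      half * t * concentration I
        ≡⟨ cong (λ z → half * t * (mass ℝ μ I * z ⁻¹)) (max-of-≤ ρs≤t) ⟩
      half * t * (mass ℝ μ I * t ⁻¹)
        ≤⟨ half*t*[a/s]≤b 1# 0≤t (mass-nonneg I) 0≤t (λ t≡0 → 0≢t (sym t≡0))
                          (≤-reflexive (sym (*-identityˡ _))) t≤two*t ⟩
      mass ℝ μ I ∎
      where
      open ≤-Reasoning
      t≤two*t : t * 1# ≤ two * t
      t≤two*t = begin
        t * 1#         ≡⟨ solve 1 (λ T → T :* con 1 := T :+ con 0) refl t ⟩
        t + 0#         ≤⟨ +-mono₂-≤ ≤-refl 0≤t ⟩
        t + t          ≡⟨ solve 1 (λ T → T :+ T := (con 1 :+ con 1) :* T) refl t ⟩
        two * t        ∎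

    ∃-short-heavy-piece-at-scale :
      ∀ I → I ∈𝓘 𝓘 → ∀ {s' L'} → size (star I) ≡ suc s' → L' ℕ.≤ s' →
      ρ * ℕ→R L' ≤ t → t ≤ ρ * ℕ→R (suc L') →
      Σ (CInterval m) λ P → P ∈𝓘 𝓘 × ρ * ℕ→R (size (star P)) ≤ t ×
        half * t * (mass ℝ μ I * (ρ * ℕ→R (suc s')) ⁻¹) ≤ mass ℝ μ P
    ∃-short-heavy-piece-at-scale I I∈𝓘 {s'} {L'} size*≡ L'≤s' ρL'≤t t≤ρ[1+L'] =
      let P , (P∈𝓘 , P*≤L') , mass≤ = ∃-heavy-piece 𝓘 I I∈𝓘 (size≡suc-size-star I 0<size*) L' q r
                                        (trans size*≡ s≡r+qL) (ℕP.≤-pred (ℕD.m%n<n s L))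
      in  P , P∈𝓘 , ≤-trans (*-monoˡ-≤ 0≤ρ (ℕ→R-mono P*≤L')) ρL'≤t ,
          half*t*[a/s]≤b (ℕ→R (suc q)) 0≤t (mass-nonneg P) (≤-trans 0≤t t≤ρs) ρs≢0
                         mass≤ t[1+q]≤2ρs
      where
      open ≤-Reasoning
      s = suc s'
      L = suc L'
      q = s ℕD./ L
      r = s ℕD.% L

      s≡r+qL : s ≡ r ℕ.+ q ℕ.* L
      s≡r+qL = ℕD.m≡m%n+[m/n]*n s L

      0<size* : 0 ℕ.< size (star I)
      0<size* = subst (0 ℕ.<_) (sym size*≡) (s≤s z≤n)

      t≤ρs : t ≤ ρ * ℕ→R s
      t≤ρs = ≤-trans t≤ρ[1+L'] (*-monoˡ-≤ 0≤ρ (ℕ→R-mono (s≤s L'≤s')))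

      ρs≢0 : ρ * ℕ→R s ≢ 0#
      ρs≢0 ρs≡0 = 0≢t (≤-antisym 0≤t (≤-trans t≤ρs (≤-reflexive ρs≡0)))

      L*[1+q]≤2s : L ℕ.* suc q ℕ.≤ s ℕ.+ s
      L*[1+q]≤2s = subst (λ z → L ℕ.* suc q ℕ.≤ z ℕ.+ z) (sym s≡r+qL)
                         (L*[1+q]≤2*[r+q*L] L q r (subst (L ℕ.≤_) s≡r+qL (s≤s L'≤s')))

      t[1+q]≤2ρs : t * ℕ→R (suc q) ≤ two * (ρ * ℕ→R s)
      t[1+q]≤2ρs = begin
        t * ℕ→R (suc q)                ≤⟨ *-monoʳ-≤ (0≤ℕ→R (suc q)) t≤ρ[1+L'] ⟩
        ρ * ℕ→R L * ℕ→R (suc q)        ≡⟨ *-assoc ρ (ℕ→R L) (ℕ→R (suc q)) ⟩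
        ρ * (ℕ→R L * ℕ→R (suc q))      ≡⟨ cong (ρ *_) (ℕ→R-* L (suc q)) ⟨
        ρ * ℕ→R (L ℕ.* suc q)          ≤⟨ *-monoˡ-≤ 0≤ρ (ℕ→R-mono L*[1+q]≤2s) ⟩
        ρ * ℕ→R (s ℕ.+ s)              ≡⟨ cong (ρ *_) (ℕ→R-+ s s) ⟩
        ρ * (ℕ→R s + ℕ→R s)            ≡⟨ solve 2 (λ R S → R :* (S :+ S) := (con 1 :+ con 1) :* (R :* S)) refl _ _ ⟩
        two * (ρ * ℕ→R s)              ∎

    ∃-short-heavy-piece : ∀ I → I ∈𝓘 𝓘 → t ≤ ρ * ℕ→R (size (star I)) →
                          Σ (CInterval m) λ P → P ∈𝓘 𝓘 × ρ * ℕ→R (size (star P)) ≤ t ×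
                            half * t * (mass ℝ μ I * (ρ * ℕ→R (size (star I))) ⁻¹) ≤ mass ℝ μ P
    ∃-short-heavy-piece I I∈𝓘 t≤ρs with size (star I) in size*≡
    ... | zero   = ⊥-elim (0≢t (≤-antisym 0≤t (≤-trans t≤ρs (≤-reflexive (zeroʳ ρ)))))
    ... | suc s' =
      let L' , L'≤s' , ρL'≤t , t≤ρ[1+L'] = ∃-crossing (λ k → ρ * ℕ→R k) t s' ρ0≤t t≤ρs
      in  ∃-short-heavy-piece-at-scale I I∈𝓘 size*≡ L'≤s' ρL'≤t t≤ρ[1+L']

    ∃-short-interval-capturing : ∀ I → I ∈𝓘 𝓘 →
      Σ (CInterval m) λ P → P ∈𝓘 𝓘 × ρ * ℕ→R (size (star P)) ≤ t ×
        half * t * concentration I ≤ mass ℝ μ P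
    ∃-short-interval-capturing I I∈𝓘 =
      [ (λ ρs≤t → I , I∈𝓘 , ρs≤t , half*t*concentration≤mass I ρs≤t)
      , (λ t≤ρs → let P , P∈𝓘 , ρp≤t , captured = ∃-short-heavy-piece I I∈𝓘 t≤ρs
                  in  P , P∈𝓘 , ρp≤t , ≤-trans (≤-reflexive (max-is-ρs t≤ρs)) captured)
      ]′ (total (ρ * ℕ→R (size (star I))) t)
      where
      max-is-ρs : t ≤ ρ * ℕ→R (size (star I)) →
                  half * t * concentration I ≡ half * t * (mass ℝ μ I * (ρ * ℕ→R (size (star I))) ⁻¹)
      max-is-ρs t≤ρs = cong (λ z → half * t * (mass ℝ μ I * z ⁻¹)) (max-of-≥ t≤ρs)

    ∃-short-interval-capturing-half :
      Σ (CInterval m) λ I → I ∈𝓘 𝓘 × ρ * ℕ→R (size (star I)) ≤ t ×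
        half * t * relConc ℝ 𝓘 ρ t μ ≤ mass ℝ μ I
    ∃-short-interval-capturing-half
      with maxList-attained concentration (filter (_∈𝓘? 𝓘) (boundedIntervals m))
    ... | inj₁ R≡0 = empty-interval , empty-interval-∈𝓘 𝓘 , ρ0≤t ,
                     ≤-reflexive (trans (cong (λ z → half * t * z) R≡0) (zeroʳ (half * t)))
    ... | inj₂ (I , I∈ , R≡) =
      let P , P∈𝓘 , ρp≤t , captured = ∃-short-interval-capturing I (proj₂ (∈-filter⁻ (_∈𝓘? 𝓘) I∈))
      in  P , P∈𝓘 , ρp≤t , ≤-trans (≤-reflexive (cong (λ z → half * t * z) R≡)) captured

proposition4p19 : (ℝ : RealField) → (𝓘 : Family) → (m : ℕ) →
    (ρ t : RealField.Carrier ℝ) → (μ : Fin (suc m) → RealField.Carrier ℝ) →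
    RealField._<_ ℝ (RealField.0# ℝ) ρ → RealField._≤_ ℝ ρ (RealField.1# ℝ) →
    RealField._<_ ℝ (RealField.0# ℝ) t → IsProbability ℝ μ →
    Σ (CInterval m) (λ I → (I ∈𝓘 𝓘) ×
      RealField._≤_ ℝ (RealField._*_ ℝ ρ (RealField.ℕ→R ℝ (size (star I)))) t ×
      RealField._≤_ ℝ
        (RealField._*_ ℝ (RealField._*_ ℝ (RealField._⁻¹ ℝ (RealField._+_ ℝ (RealField.1# ℝ) (RealField.1# ℝ))) t)
          (relConc ℝ 𝓘 ρ t μ))
        (mass ℝ μ I))
proposition4p19 ℝ 𝓘 m ρ t μ (0≤ρ , _) _ (0≤t , 0≢t) (μ≥0 , _) =
  ∃-short-interval-capturing-half 𝓘 0≤ρ 0≤t 0≢t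
  where open Concentration ℝ μ μ≥0
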